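{- Let $\Delta\vdash\sigma:\Gamma$ be a derivable substitution in $\mathsf{MCaTT}$ (all expressions taken in normal form). Then for every derivable type $\Gamma\vdash A$ we have $S(A[\sigma])=(SA)[S\sigma]$; for every derivable term $\Gamma\vdash t:A$ we have $S(t[\sigma])=(St)[S\sigma]$; and for every derivable substitution $\Gamma\vdash\delta:\Theta$ we have $S(\delta\circ\sigma)=S\delta\circ S\sigma$.
   Context: Substitution on variables: $x[\langle\rangle]=x$, $x[\langle\sigma,y\mapsto t\rangle]=t$ if $x=y$ else $x[\sigma]$; composition $\langle\rangle\circ\delta=\langle\rangle$, $\langle\sigma,x\mapsto t\rangle\circ\delta=\langle\sigma\circ\delta,x\mapsto t[\delta]\rangle$. $\mathsf{CaTT}$: types $\star$, $\mathrm{Hom}_A\,t\,u$; terms: variables, $\mathrm{op}_{\Theta,A}[\tau]$, $\mathrm{coh}_{\Theta,A}[\tau]$; $\star[\sigma]=\star$, $(\mathrm{Hom}_Atu)[\sigma]=\mathrm{Hom}_{A[\sigma]}t[\sigma]u[\sigma]$, $\mathrm{op}_{\Theta,A}[\tau][\sigma]=\mathrm{op}_{\Theta,A}[\tau\circ\sigma]$ (same for coh). $\mathsf{MCaTT}$ (a dependent type theory with the standard structural rules for contexts, variables and substitutions): types $\mathbf 1$, $\mathrm{Hom}_Atu$; terms: variables, the constant $()$, $\mathrm{mop}_{\Theta,A}[\tau]$, $\mathrm{mcoh}_{\Theta,A}[\tau]$ with $\Theta$ a $\mathsf{CaTT}$ context and $A$ a $\mathsf{CaTT}$ type; $\mathbf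 1[\sigma]=\mathbf 1$, $()[\sigma]=()$, $\mathrm{mop}_{\Theta,A}[\tau][\sigma]=\mathrm{mop}_{\Theta,A}[\tau\circ\sigma]$ (same for mcoh); a term $\Delta\vdash\mathrm{mop}_{\Theta,A}[\tau]$ or $\mathrm{mcoh}_{\Theta,A}[\tau]$ requires $\Delta\vdash\tau:\Downarrow\Theta$; there is a unit type rule: $\Gamma\vdash():\mathbf 1$, and every term of type $\mathbf 1$ is definitionally equal to $()$; expressions are taken in normal form, where every term of type $\mathbf 1$ is $()$. $\mathsf{MCaTT}$'s $\star$ denotes $\mathrm{Hom}_{\mathbf 1}()()$. Desuspension $\Downarrow$ ($\mathsf{CaTT}\to\mathsf{MCaTT}$ raw syntax): $\Downarrow\varnothing=\varnothing$, $\Downarrow(\Gamma,x:A)=(\Downarrow\Gamma,x:\Downarrow A)$, $\Downarrow\star=\mathbf 1$, $\Downarrow\mathrm{Hom}_Atu=\mathrm{Hom}_{\Downarrow A}\Downarrow t\Downarrow u$, $\Downarrow x=x$. Reduced suspension $S$. Fix a fresh variable $\bullet$. On derivable $\mathsf{MCaTT}$ expressions in normal form: $S\varnothing=(\bullet:\star)$; $S(\Gamma,x:\mathbf 1)=S\Gamma$; $S(\Gamma,x:A)=(S\Gamma,x:SA)$ for $A\ne\mathbf 1$; $S\mathbf 1=\star$; $S\mathrm{Hom}_Atu=\mathrm{Hom}_{SA}St\,Su$; $S()=\bullet$; $Sx=x$ for a variable of type $\neq\mathbf 1$; $S\mathrm{mop}_{\Theta,A}[\tau]=\mathrm{op}_{\Theta,A}[\rho_\Theta\circ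 S\tau]$, $S\mathrm{mcoh}_{\Theta,A}[\tau]=\mathrm{coh}_{\Theta,A}[\rho_\Theta\circ S\tau]$; $S\langle\rangle=\langle\bullet\mapsto\bullet\rangle$; for $\Delta\vdash\langle\tau,x\mapsto t\rangle:(\Gamma,x:A)$, $S\langle\tau,x\mapsto t\rangle=S\tau$ if $A=\mathbf 1$ and $\langle S\tau,x\mapsto St\rangle$ otherwise. For a $\mathsf{CaTT}$ context $\Theta$: $\rho_\varnothing=\langle\rangle$, $\rho_{(\Theta,x:A)}=\langle\rho_\Theta,x\mapsto S(\Downarrow x)\rangle$ (this is $\bullet$ if $A=\star$ and $x$ otherwise). -}

module Defs where

open import Data.Nat using (ℕ; zero; suc; _≡ᵇ_)
open import Data.Bool using (if_then_else_)
open import Data.Product using (_×_; _,_)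
open import Relation.Binary.PropositionalEquality using (_≡_; _≢_)

-- Variables are natural numbers; the fixed fresh variable • is 0.
-- Freshness of • in MCaTT is enforced by the context/substitution rules.

Var : Set
Var = ℕ

• : Var
• = zero

data CTy  : Set
data CTm  : Set
data CSub : Set
data CCtx : Set

data CCtx where
  c∅    : CCtx
  _c,_∶_ : CCtx → Var → CTy → CCtx

data CTy where
  ⋆    : CTy
  CHom : CTy → CTm → CTm → CTy

data CTm where
  cvar : Var → CTm
  op   : CCtx → CTy → CSub → CTm
  coh  : CCtx → CTy → CSub → CTm

data CSub where
  c⟨⟩    : CSub
  _c,_↦_ : CSub → Var → CTm → CSub

clookup : Var → CSub → CTm
_[_]c   : CTm → CSub → CTm
_∘c_    : CSub → CSub → CSub

clookup x c⟨⟩ = cvar x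
clookup x (σ c, y ↦ t) = if x ≡ᵇ y then t else clookup x σ

cvar x     [ σ ]c = clookup x σ
op  Θ A τ  [ σ ]c = op  Θ A (τ ∘c σ)
coh Θ A τ  [ σ ]c = coh Θ A (τ ∘c σ)

c⟨⟩ ∘c δ = c⟨⟩
(σ c, x ↦ t) ∘c δ = (σ ∘c δ) c, x ↦ (t [ δ ]c)

_[_]cty : CTy → CSub → CTy
⋆ [ σ ]cty = ⋆
CHom A t u [ σ ]cty = CHom (A [ σ ]cty) (t [ σ ]c) (u [ σ ]c)

data Ty  : Set
data Tm  : Set
data Sub : Set
data Ctx : Set

data Ctx where
  ∅     : Ctx
  _,_∶_ : Ctx → Var → Ty → Ctx

data Ty where
  𝟏   : Ty
  Hom : Ty → Tm → Tm → Ty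

data Tm where
  var  : Var → Tm
  unit : Tm
  mop  : CCtx → CTy → Sub → Tm
  mcoh : CCtx → CTy → Sub → Tm

data Sub where
  ⟨⟩    : Sub
  _,_↦_ : Sub → Var → Tm → Sub

⋆M : Ty
⋆M = Hom 𝟏 unit unit

lookupM : Var → Sub → Tm
_[_]    : Tm → Sub → Tm
_∘_     : Sub → Sub → Sub

lookupM x ⟨⟩ = var x
lookupM x (σ , y ↦ t) = if x ≡ᵇ y then t else lookupM x σ

var x      [ σ ] = lookupM x σ
unit       [ σ ] = unit
mop  Θ A τ [ σ ] = mop  Θ A (τ ∘ σ)
mcoh Θ A τ [ σ ] = mcoh Θ A (τ ∘ σ)

⟨⟩ ∘ δ = ⟨⟩
(σ , x ↦ t) ∘ δ = (σ ∘ δ) , x ↦ (t [ δ ])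

_[_]ty : Ty → Sub → Ty
𝟏 [ σ ]ty = 𝟏
Hom A t u [ σ ]ty = Hom (A [ σ ]ty) (t [ σ ]) (u [ σ ])

⇓ty  : CTy → Ty
⇓tm  : CTm → Tm
⇓sub : CSub → Sub

⇓ty ⋆ = 𝟏
⇓ty (CHom A t u) = Hom (⇓ty A) (⇓tm t) (⇓tm u)

⇓tm (cvar x)    = var x
⇓tm (op Θ A γ)  = mop  Θ A (⇓sub γ)
⇓tm (coh Θ A γ) = mcoh Θ A (⇓sub γ)

⇓sub c⟨⟩ = ⟨⟩
⇓sub (γ c, x ↦ t) = ⇓sub γ , x ↦ ⇓tm t

⇓ctx : CCtx → Ctx
⇓ctx c∅ = ∅
⇓ctx (Θ c, x ∶ A) = ⇓ctx Θ , x ∶ ⇓ty A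

data _∶_∈_ : Var → Ty → Ctx → Set where
  here  : ∀ {Γ x A} → x ∶ A ∈ (Γ , x ∶ A)
  there : ∀ {Γ x A y B} → x ≢ y → x ∶ A ∈ Γ → x ∶ A ∈ (Γ , y ∶ B)

data _∉_ : Var → Ctx → Set where
  ∉∅ : ∀ {x} → x ∉ ∅
  ∉, : ∀ {Γ x y B} → x ≢ y → x ∉ Γ → x ∉ (Γ , y ∶ B)

-- Derivability in MCaTT, for expressions in normal form.
-- Parameterised by the side conditions OpOK / CohOK on (Θ , A) required
-- by the mop / mcoh rules (Θ ⊢ps, Θ ⊢ A, support conditions, ...).

module Typing (OpOK CohOK : CCtx → CTy → Set) where

  data ⊢_        : Ctx → Set
  data _⊢ty_     : Ctx → Ty → Set
  data _⊢_∶_     : Ctx → Tm → Ty → Set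
  data _⊢s_∶_    : Ctx → Sub → Ctx → Set

  data ⊢_ where
    ⊢∅ : ⊢ ∅
    ⊢, : ∀ {Γ x A} → ⊢ Γ → Γ ⊢ty A → x ∉ Γ → x ≢ • → ⊢ (Γ , x ∶ A)

  data _⊢ty_ where
    𝟏-intro   : ∀ {Γ} → ⊢ Γ → Γ ⊢ty 𝟏
    Hom-intro : ∀ {Γ A t u} → Γ ⊢ty A → Γ ⊢ t ∶ A → Γ ⊢ u ∶ A → Γ ⊢ty Hom A t u

  data _⊢_∶_ where
    -- normal form: variables of type 𝟏 are replaced by ()
    var-intro  : ∀ {Γ x A} → ⊢ Γ → x ∶ A ∈ Γ → A ≢ 𝟏 → Γ ⊢ var x ∶ A
    unit-intro : ∀ {Γ} → ⊢ Γ → Γ ⊢ unit ∶ 𝟏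
    -- normal form: A ≢ ⋆, since otherwise the term has type 𝟏 (and is ())
    mop-intro  : ∀ {Δ Θ A τ} → OpOK Θ A → A ≢ ⋆ → Δ ⊢s τ ∶ ⇓ctx Θ →
                 Δ ⊢ mop Θ A τ ∶ (⇓ty A [ τ ]ty)
    mcoh-intro : ∀ {Δ Θ A τ} → CohOK Θ A → A ≢ ⋆ → Δ ⊢s τ ∶ ⇓ctx Θ →
                 Δ ⊢ mcoh Θ A τ ∶ (⇓ty A [ τ ]ty)

  data _⊢s_∶_ where
    ⟨⟩-intro : ∀ {Δ} → ⊢ Δ → Δ ⊢s ⟨⟩ ∶ ∅
    ,-intro  : ∀ {Δ Γ τ x A t} → Δ ⊢s τ ∶ Γ → x ∉ Γ → x ≢ • →
               Δ ⊢ t ∶ (A [ τ ]ty) → Δ ⊢s (τ , x ↦ t) ∶ (Γ , x ∶ A)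

ρ : CCtx → CSub
ρ c∅ = c⟨⟩
ρ (Θ c, x ∶ ⋆) = ρ Θ c, x ↦ cvar •
ρ (Θ c, x ∶ CHom A t u) = ρ Θ c, x ↦ cvar x

STy  : Ty → CTy
STm  : Tm → CTm
SSub : Sub → Ctx → CSub

STy 𝟏 = ⋆
STy (Hom A t u) = CHom (STy A) (STm t) (STm u)

STm (var x) = cvar x
STm unit = cvar •
STm (mop  Θ A τ) = op  Θ A (ρ Θ ∘c SSub τ (⇓ctx Θ))
STm (mcoh Θ A τ) = coh Θ A (ρ Θ ∘c SSub τ (⇓ctx Θ))

SSub ⟨⟩ _ = c⟨⟩ c, • ↦ cvar •
SSub (τ , x ↦ t) (Γ , y ∶ 𝟏) = SSub τ Γ
SSub (τ , x ↦ t) (Γ , y ∶ Hom A u v) = SSub τ Γ c, x ↦ STm t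
SSub (τ , x ↦ t) ∅ = c⟨⟩ c, • ↦ cvar •   -- ill-typed case, irrelevant

SCtx : Ctx → CCtx
SCtx ∅ = c∅ c, • ∶ ⋆
SCtx (Γ , x ∶ 𝟏) = SCtx Γ
SCtx (Γ , x ∶ Hom A t u) = SCtx Γ c, x ∶ STy (Hom A t u)

{-# OPTIONS --safe #-}
module Submission where

open import Defs
open import Data.Bool using (true; false)
open import Data.Nat using (_≡ᵇ_; _≟_)
open import Data.Product using (_×_; _,_)
open import Data.Empty using (⊥-elim)
open import Relation.Nullary.Decidable using (dec-true; dec-false)
open import Relation.Binary.PropositionalEquality
  using (_≡_; _≢_; refl; sym; trans; cong; cong₂; ≢-sym; module ≡-Reasoning)

-- The only
-- non-structural points are the two places where S introduces •: S () = •, which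
-- S σ fixes because a well-typed σ never binds •, and ρ_Θ, whose entries are •
-- or variables of Θ; so ρ_Θ ∘ (S τ ∘ S σ) = (ρ_Θ ∘ S τ) ∘ S σ holds although
-- composition of CaTT substitutions is not associative in general.

≡ᵇ-refl : ∀ x → (x ≡ᵇ x) ≡ true
≡ᵇ-refl x = dec-true (x ≟ x) refl

≢⇒≡ᵇ≡false : ∀ {x y} → x ≢ y → (x ≡ᵇ y) ≡ false
≢⇒≡ᵇ≡false {x} {y} = dec-false (x ≟ y)

clookup-∘c : ∀ x b c → clookup x c ≡ cvar x →
             clookup x (b ∘c c) ≡ clookup x b [ c ]c
clookup-∘c x c⟨⟩ c c-fixes-x = sym c-fixes-x
clookup-∘c x (b c, y ↦ t) c c-fixes-x with x ≡ᵇ y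
... | true  = refl
... | false = clookup-∘c x b c c-fixes-x

module _ (OpOK CohOK : CCtx → CTy → Set) where
  open Typing OpOK CohOK

  SSub-fixes-• : ∀ {Δ Γ σ} → Δ ⊢s σ ∶ Γ → clookup • (SSub σ Γ) ≡ cvar •
  SSub-fixes-• (⟨⟩-intro _) = refl
  SSub-fixes-• (,-intro {A = 𝟏} dσ _ _ _) = SSub-fixes-• dσ
  SSub-fixes-• (,-intro {x = x} {A = Hom _ _ _} dσ _ x≢• _)
    rewrite ≢⇒≡ᵇ≡false (≢-sym x≢•) = SSub-fixes-• dσ

  STm-lookupM : ∀ {Δ Γ σ x A} → Δ ⊢s σ ∶ Γ → x ∶ A ∈ Γ → A ≢ 𝟏 →
                STm (lookupM x σ) ≡ clookup x (SSub σ Γ)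
  STm-lookupM (,-intro {A = 𝟏} _ _ _ _) here A≢𝟏 = ⊥-elim (A≢𝟏 refl)
  STm-lookupM (,-intro {x = x} {A = Hom _ _ _} _ _ _ _) here _
    rewrite ≡ᵇ-refl x = refl
  STm-lookupM (,-intro {A = 𝟏} dσ _ _ _) (there x≢y x∈Γ) A≢𝟏
    rewrite ≢⇒≡ᵇ≡false x≢y = STm-lookupM dσ x∈Γ A≢𝟏
  STm-lookupM (,-intro {A = Hom _ _ _} dσ _ _ _) (there x≢y x∈Γ) A≢𝟏
    rewrite ≢⇒≡ᵇ≡false x≢y = STm-lookupM dσ x∈Γ A≢𝟏

  ρ-∘c-fresh : ∀ {x} Θ → x ∉ ⇓ctx Θ → x ≢ • → ∀ b t →
               ρ Θ ∘c (b c, x ↦ t) ≡ ρ Θ ∘c b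
  ρ-∘c-fresh c∅ _ _ _ _ = refl
  ρ-∘c-fresh (Θ c, y ∶ ⋆) (∉, _ x∉Θ) x≢• b t
    rewrite ≢⇒≡ᵇ≡false (≢-sym x≢•) =
      cong (_c, y ↦ clookup • b) (ρ-∘c-fresh Θ x∉Θ x≢• b t)
  ρ-∘c-fresh (Θ c, y ∶ CHom _ _ _) (∉, x≢y x∉Θ) x≢• b t
    rewrite ≢⇒≡ᵇ≡false (≢-sym x≢y) =
      cong (_c, y ↦ clookup y b) (ρ-∘c-fresh Θ x∉Θ x≢• b t)

  ρ-∘c-assoc : ∀ {Δ τ} Θ → Δ ⊢s τ ∶ ⇓ctx Θ → ∀ c → clookup • c ≡ cvar • →
               ρ Θ ∘c (SSub τ (⇓ctx Θ) ∘c c) ≡ (ρ Θ ∘c SSub τ (⇓ctx Θ)) ∘c c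
  ρ-∘c-assoc c∅ _ _ _ = refl
  ρ-∘c-assoc (Θ c, x ∶ ⋆) (,-intro {τ = τ} dτ _ _ _) c c-fixes-• =
    cong₂ (_c, x ↦_) (ρ-∘c-assoc Θ dτ c c-fixes-•)
                     (clookup-∘c • (SSub τ (⇓ctx Θ)) c c-fixes-•)
  ρ-∘c-assoc (Θ c, x ∶ CHom _ _ _) (,-intro {τ = τ} {t = s} dτ x∉Θ x≢• _) c c-fixes-•
    rewrite ≡ᵇ-refl x = cong (_c, x ↦ (STm s [ c ]c)) (begin
      ρ Θ ∘c ((b ∘c c) c, x ↦ (STm s [ c ]c)) ≡⟨ ρ-∘c-fresh Θ x∉Θ x≢• (b ∘c c) _ ⟩
      ρ Θ ∘c (b ∘c c)                         ≡⟨ ρ-∘c-assoc Θ dτ c c-fixes-• ⟩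
      (ρ Θ ∘c b) ∘c c                         ≡⟨ cong (_∘c c) (ρ-∘c-fresh Θ x∉Θ x≢• b (STm s)) ⟨
      (ρ Θ ∘c (b c, x ↦ STm s)) ∘c c          ∎)
    where
      open ≡-Reasoning
      b = SSub τ (⇓ctx Θ)

  module _ {Δ Γ σ} (dσ : Δ ⊢s σ ∶ Γ) where
    STy-[]ty : ∀ {A} → Γ ⊢ty A → STy (A [ σ ]ty) ≡ STy A [ SSub σ Γ ]cty
    STm-[]   : ∀ {t A} → Γ ⊢ t ∶ A → STm (t [ σ ]) ≡ STm t [ SSub σ Γ ]c
    SSub-∘   : ∀ {Θ δ} → Γ ⊢s δ ∶ Θ → SSub (δ ∘ σ) Θ ≡ SSub δ Θ ∘c SSub σ Γ
    ρ-SSub-∘ : ∀ {Θ τ} → Γ ⊢s τ ∶ ⇓ctx Θ →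
               ρ Θ ∘c SSub (τ ∘ σ) (⇓ctx Θ) ≡ (ρ Θ ∘c SSub τ (⇓ctx Θ)) ∘c SSub σ Γ

    STy-[]ty (𝟏-intro _) = refl
    STy-[]ty (Hom-intro dA dt du)
      rewrite STy-[]ty dA | STm-[] dt | STm-[] du = refl

    STm-[] (var-intro _ x∈Γ A≢𝟏) = STm-lookupM dσ x∈Γ A≢𝟏
    STm-[] (unit-intro _)         = sym (SSub-fixes-• dσ)
    STm-[] (mop-intro {Θ = Θ} {A} _ _ dτ)  = cong (op Θ A)  (ρ-SSub-∘ dτ)
    STm-[] (mcoh-intro {Θ = Θ} {A} _ _ dτ) = cong (coh Θ A) (ρ-SSub-∘ dτ)

    SSub-∘ (⟨⟩-intro _) = cong (c⟨⟩ c, • ↦_) (sym (SSub-fixes-• dσ))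
    SSub-∘ (,-intro {A = 𝟏} dδ _ _ _) = SSub-∘ dδ
    SSub-∘ (,-intro {x = x} {A = Hom _ _ _} dδ _ _ dt) =
      cong₂ (_c, x ↦_) (SSub-∘ dδ) (STm-[] dt)

    ρ-SSub-∘ {Θ} dτ =
      trans (cong (ρ Θ ∘c_) (SSub-∘ dτ)) (ρ-∘c-assoc Θ dτ (SSub σ Γ) (SSub-fixes-• dσ))

mainTheorem10 : (OpOK CohOK : CCtx → CTy → Set) →
    let open Typing OpOK CohOK in
    ∀ {Δ Γ σ} → Δ ⊢s σ ∶ Γ →
      (∀ {A} → Γ ⊢ty A → STy (A [ σ ]ty) ≡ (STy A [ SSub σ Γ ]cty))
      × (∀ {t A} → Γ ⊢ t ∶ A → STm (t [ σ ]) ≡ (STm t [ SSub σ Γ ]c))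
      × (∀ {Θ δ} → Γ ⊢s δ ∶ Θ → SSub (δ ∘ σ) Θ ≡ (SSub δ Θ ∘c SSub σ Γ))
mainTheorem10 OpOK CohOK dσ =
  STy-[]ty OpOK CohOK dσ , STm-[] OpOK CohOK dσ , SSub-∘ OpOK CohOK dσ
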